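{- Setup: - Let $G=(V,E)$ and $G'=(V',E')$ be graphs, and let $z\in V'$. - Let $\mathcal G=\langle G,h,g\rangle$ and $\mathcal G'=\langle G',h',g'\rangle$ be winning games. - Let $I\subseteq S\subseteq V$ be such that $(S,I)$ is a predictable pair for some winning strategy of $\mathcal G$. - Assume that for each $v\in I$ there are natural numbers $s_v,a_v,b'_v$ with $g(v)=s_va_v$ and $h'(z)=s_vb'_v$. - Let $\widetilde G$ be the graph with vertex set $V\cup V'\setminus\{z\}$ and edge set $E\cup E(G'\setminus\{z\})\cup\{uw: u\in S,\ w\in N_{G'}(z)\}$. Conclusion: the game $\widetilde{\mathcal G}=\langle\widetilde G,\widetilde h,\widetilde g\rangle$ is winning, where $(\widetilde h(u),\widetilde g(u))$ equals - $(h(u),g(u))$ for $u\in V\setminus S$; - $(h'(u),g'(u))$ for $u\in V'\setminus\{z\}$; - $(h(u)h'(z),\,g(u)g'(z))$ for $u\in S\setminus I$; - $(h(u)b'_u,\,a_ug'(z))$ for $u\in I$.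
   Context: Hat guessing game $\langle G,h,g\rangle$: $G=(V,E)$ is a finite graph and $h,g\colon V\to\mathbb N$. The adversary gives each vertex $v$ a color in $\{0,\dots,h(v)-1\}$. Each vertex sees only its neighbors' colors and names at most $g(v)$ colors, according to a deterministic strategy fixed in advance that depends only on the neighbors' colors. A strategy is winning if for every assignment some vertex names its own color. The game is winning if a winning strategy exists. $N_{G'}(z)$ denotes the neighborhood of $z$ in $G'$. Predictable pair: fix a strategy of the sages in $\langle G,h,g\rangle$ and let $I\subseteq S\subseteq V$. The pair $(S,I)$ is predictable (for this strategy) if there exists an algorithm with the following two properties, holding for every hat assignment on $V$: 1. Using only the hat colors on $S$, it determines a vertex $u\in S$ that guessed his color correctly, provided that at least one vertex of $S$ guessed correctly. 2. If the determined $u$ lies in $I$, it also determines the set $A_u$ of colors named by $u$ under the strategy. -}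

module Defs where

open import Data.Nat using (ℕ; suc; _+_; _*_; _≤_)
open import Data.Fin using (Fin; splitAt; punchIn)
open import Data.Fin.Subset using (Subset; _∈_; ∣_∣)
open import Data.Vec using (lookup)
open import Data.Bool using (Bool; true; false; T; _∧_; if_then_else_)
open import Data.Bool.Properties using (∧-comm)
open import Data.Sum using (_⊎_; inj₁; inj₂)
open import Data.Product using (Σ; ∃; _×_; _,_)
open import Relation.Binary.PropositionalEquality using (_≡_; refl; cong₂)

record Graph (n : ℕ) : Set where
  field
    adj    : Fin n → Fin n → Bool
    sym    : ∀ u v → adj u v ≡ adj v u
    irrefl : ∀ v → adj v v ≡ false
open Graph public

Coloring : ∀ {n} → (Fin n → ℕ) → Set
Coloring {n} h = (v : Fin n) → Fin (h v)

NbView : ∀ {n} → Graph n → (h : Fin n → ℕ) → Fin n → Set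
NbView {n} G h v = (u : Fin n) → T (adj G v u) → Fin (h u)

record Strategy {n} (G : Graph n) (h g : Fin n → ℕ) : Set where
  field
    guess : (v : Fin n) → NbView G h v → Subset (h v)
    bound : ∀ v (view : NbView G h v) → ∣ guess v view ∣ ≤ g v
open Strategy public

guesses : ∀ {n} {G : Graph n} {h g : Fin n → ℕ} →
          Strategy G h g → Coloring h → (v : Fin n) → Subset (h v)
guesses σ c v = guess σ v (λ u _ → c u)

Correct : ∀ {n} {G : Graph n} {h g : Fin n → ℕ} →
          Strategy G h g → Coloring h → Fin n → Set
Correct σ c v = c v ∈ guesses σ c v

Winning : ∀ {n} {G : Graph n} {h g : Fin n → ℕ} → Strategy G h g → Set
Winning {n} {h = h} σ = (c : Coloring h) → ∃ λ (v : Fin n) → Correct σ c v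

WinningGame : ∀ {n} (G : Graph n) (h g : Fin n → ℕ) → Set
WinningGame G h g = Σ (Strategy G h g) Winning

SView : ∀ {n} → Subset n → (Fin n → ℕ) → Set
SView {n} S h = (v : Fin n) → v ∈ S → Fin (h v)

restrict : ∀ {n} {h : Fin n → ℕ} (S : Subset n) → Coloring h → SView S h
restrict S c = λ v _ → c v

record Predictable {n} {G : Graph n} {h g : Fin n → ℕ}
                   (σ : Strategy G h g) (S I : Subset n) : Set where
  field
    pick          : SView S h → Fin n
    pickCorrect   : ∀ (c : Coloring h) →
                    (∃ λ w → w ∈ S × Correct σ c w) →
                    (pick (restrict S c) ∈ S) × Correct σ c (pick (restrict S c))
    answer        : (r : SView S h) → pick r ∈ I → Subset (h (pick r))
    answerCorrect : ∀ (c : Coloring h) (p : pick (restrict S c) ∈ I) →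
                    answer (restrict S c) p ≡ guesses σ c (pick (restrict S c))

-- The glued graph G̃ on V ∪ V' ∖ {z}.
-- Vertices: Fin (n + m); via splitAt n, inj₁ v is v ∈ V and inj₂ x is the
-- vertex punchIn z x ∈ V' ∖ {z} (punchIn z enumerates Fin (suc m) ∖ {z}).

module _ {n m : ℕ} (G : Graph n) (G' : Graph (suc m)) (z : Fin (suc m))
         (S : Subset n) where

  adjSum : Fin n ⊎ Fin m → Fin n ⊎ Fin m → Bool
  adjSum (inj₁ u) (inj₁ w) = adj G u w
  adjSum (inj₂ x) (inj₂ y) = adj G' (punchIn z x) (punchIn z y)
  adjSum (inj₁ u) (inj₂ y) = lookup S u ∧ adj G' z (punchIn z y)
  adjSum (inj₂ x) (inj₁ w) = adj G' z (punchIn z x) ∧ lookup S w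

  adjSum-sym : ∀ p q → adjSum p q ≡ adjSum q p
  adjSum-sym (inj₁ u) (inj₁ w) = sym G u w
  adjSum-sym (inj₂ x) (inj₂ y) = sym G' (punchIn z x) (punchIn z y)
  adjSum-sym (inj₁ u) (inj₂ y) = ∧-comm (lookup S u) _
  adjSum-sym (inj₂ x) (inj₁ w) = ∧-comm _ (lookup S w)

  adjSum-irrefl : ∀ p → adjSum p p ≡ false
  adjSum-irrefl (inj₁ u) = irrefl G u
  adjSum-irrefl (inj₂ x) = irrefl G' (punchIn z x)

  tildeGraph : Graph (n + m)
  tildeGraph = record
    { adj    = λ u v → adjSum (splitAt n u) (splitAt n v)
    ; sym    = λ u v → adjSum-sym (splitAt n u) (splitAt n v)
    ; irrefl = λ v → adjSum-irrefl (splitAt n v)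
    }

-- h̃ and g̃ (the I-test comes first; I ⊆ S is a hypothesis of the theorem)
module _ {n m : ℕ} (z : Fin (suc m)) (S I : Subset n) where

  tildeH : (h : Fin n → ℕ) (h' : Fin (suc m) → ℕ) (b : Fin n → ℕ) →
           Fin (n + m) → ℕ
  tildeH h h' b v with splitAt n v
  ... | inj₂ x = h' (punchIn z x)
  ... | inj₁ u = if lookup I u then h u * b u
                 else if lookup S u then h u * h' z
                 else h u

  tildeG : (g : Fin n → ℕ) (g' : Fin (suc m) → ℕ) (a : Fin n → ℕ) →
           Fin (n + m) → ℕ
  tildeG g g' a v with splitAt n v
  ... | inj₂ x = g' (punchIn z x)
  ... | inj₁ u = if lookup I u then a u * g' z
                 else if lookup S u then g u * g' z
                 else g u

-- Every vertex u ∈ S wears a pair of hats, one of G and an extra one, and the vertices of V play σ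
-- on the G-hats. A neighbour of z in G' sees all of S, so it can run the algorithm of the predictable
-- pair and read a colour for z off the hat of the chosen vertex u: for u ∉ I the extra hat is that
-- colour; for u ∈ I, where the algorithm also reveals the named set A_u, the colour is coded by the
-- extra hat e < b'(u) together with the block of the position of u's G-hat in A_u, the
-- |A_u| ≤ s(u)a(u) positions being cut into s(u) blocks of size a(u). The vertices of G' ∖ z play σ'
-- against this virtual colour of z, and u ∈ S names the pairs whose G-part lies in its σ-guess and
-- whose z-part lies in the σ'-guess of z; for u ∈ I the offset inside the block makes this coding
-- injective, so at most a(u)g'(z) pairs are named. If the winner of σ lies outside S it still wins.
-- Otherwise the chosen u is correct in G, the virtual colour is defined, and the winner of σ' is
-- either a vertex of G' ∖ z, which wins again, or z, in which case u wins.

module Submission where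

open import Defs hiding (sym)
open import Data.Nat using (ℕ; zero; suc; _*_; _≤_; _≤?_; z≤n; s≤s)
open import Data.Nat.Properties using (≤-trans; *-mono-≤; *-monoʳ-≤)
open import Data.Bool using (Bool; true; false; T; if_then_else_)
open import Data.Bool.Properties using (T-∧)
open import Data.Fin using (Fin; zero; suc; splitAt; join; punchIn; punchOut; inject≤; combine; remQuot; _≟_)
open import Data.Fin.Properties
  using (suc-injective; 0≢1+n; punchOut-injective; inject≤-injective; splitAt-join;
         punchIn-punchOut; punchIn-injective; punchInᵢ≢i; combine-injective; combine-remQuot)
open import Data.Fin.Subset using (Subset; _∈_; _∉_; _⊆_; ∣_∣; ⊥; inside; outside)
open import Data.Fin.Subset.Properties using (_∈?_; ∣⊥∣≡0)
open import Data.Maybe using (Maybe; just; nothing; map; maybe′; fromMaybe)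
open import Data.Maybe.Properties using (just-injective)
open import Data.Maybe.Relation.Unary.Any as Any using (Any; just)
open import Data.Product using (∃; _×_; _,_; proj₁; proj₂; uncurry)
open import Data.Sum using (_⊎_; inj₁; inj₂)
open import Data.Vec using ([]; _∷_; lookup; tabulate; here; there)
open import Data.Vec.Properties using (lookup⇒[]=; []=⇒lookup; lookup∘tabulate)
open import Data.Empty using (⊥-elim)
open import Function using (_∘_; Equivalence)
open import Relation.Nullary using (Dec; yes; no; does; contradiction; _×-dec_)
open import Relation.Nullary.Decidable using (dec-true)
open import Relation.Unary using (Pred; Decidable)
open import Relation.Binary.PropositionalEquality
open import Relation.Binary.PropositionalEquality.Properties using (subst-injective)

rank : ∀ {k} {A : Subset k} {x} → x ∈ A → Fin ∣ A ∣
rank here = zero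
rank (there {y = inside} x∈A) = suc (rank x∈A)
rank (there {y = outside} x∈A) = rank x∈A

rank-injective : ∀ {k} {A : Subset k} {x y} (x∈A : x ∈ A) (y∈A : y ∈ A) →
                 rank x∈A ≡ rank y∈A → x ≡ y
rank-injective here here _ = refl
rank-injective (there {y = inside} x∈A) (there y∈A) e = cong suc (rank-injective x∈A y∈A (suc-injective e))
rank-injective (there {y = outside} x∈A) (there y∈A) e = cong suc (rank-injective x∈A y∈A e)

∣∣≤-injection : ∀ {k l} {A : Subset k} (f : ∀ {x} → x ∈ A → Fin l) →
                (∀ {x y} (x∈A : x ∈ A) (y∈A : y ∈ A) → f x∈A ≡ f y∈A → x ≡ y) →
                ∣ A ∣ ≤ l
∣∣≤-injection {A = []} f f-inj = z≤n
∣∣≤-injection {A = outside ∷ A} f f-inj =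
  ∣∣≤-injection (λ x∈A → f (there x∈A)) λ x∈A y∈A e → suc-injective (f-inj (there x∈A) (there y∈A) e)
∣∣≤-injection {l = zero} {A = inside ∷ A} f f-inj with () ← f here
∣∣≤-injection {l = suc l} {A = inside ∷ A} f f-inj =
  s≤s (∣∣≤-injection (λ x∈A → punchOut (f-here≢ x∈A)) λ x∈A y∈A e →
    suc-injective (f-inj (there x∈A) (there y∈A) (punchOut-injective (f-here≢ x∈A) (f-here≢ y∈A) e)))
  where
  f-here≢ : ∀ {x} (x∈A : x ∈ A) → f here ≢ f (there x∈A)
  f-here≢ x∈A e = 0≢1+n (f-inj here (there x∈A) e)

index : ∀ {k} N (A : Subset k) → Fin k → Maybe (Fin N)
index N A x with x ∈? A | ∣ A ∣ ≤? N
... | yes x∈A | yes ∣A∣≤N = just (inject≤ (rank x∈A) ∣A∣≤N)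
... | _ | _ = nothing

index-complete : ∀ {k N} {A : Subset k} {x} → x ∈ A → ∣ A ∣ ≤ N → ∃ λ i → index N A x ≡ just i
index-complete {N = N} {A} {x} x∈A ∣A∣≤N with x ∈? A | ∣ A ∣ ≤? N
... | yes _ | yes _ = _ , refl
... | no x∉A | _ = contradiction x∈A x∉A
... | yes _ | no ∣A∣≰N = contradiction ∣A∣≤N ∣A∣≰N

index-injective : ∀ {k N} {A : Subset k} {x y i} → index N A x ≡ just i → index N A y ≡ just i → x ≡ y
index-injective {N = N} {A} {x} {y} ix iy with x ∈? A | y ∈? A | ∣ A ∣ ≤? N
... | yes x∈A | yes y∈A | yes ∣A∣≤N =
  rank-injective x∈A y∈A (inject≤-injective ∣A∣≤N ∣A∣≤N _ _ (just-injective (trans ix (sym iy))))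

subsetOf : ∀ {k p} {P : Pred (Fin k) p} → Decidable P → Subset k
subsetOf P? = tabulate (λ x → does (P? x))

∈subsetOf⁺ : ∀ {k p} {P : Pred (Fin k) p} (P? : Decidable P) {x} → P x → x ∈ subsetOf P?
∈subsetOf⁺ P? {x} px = lookup⇒[]= x _ (trans (lookup∘tabulate _ x) (dec-true (P? x) px))

∈subsetOf⁻ : ∀ {k p} {P : Pred (Fin k) p} (P? : Decidable P) {x} → x ∈ subsetOf P? → P x
∈subsetOf⁻ P? {x} x∈ with P? x | trans (sym (lookup∘tabulate (λ x → does (P? x)) x)) ([]=⇒lookup x∈)
... | yes px | _  = px
... | no _   | ()

∣subsetOf∣≤ : ∀ {k l p} {P : Pred (Fin k) p} (P? : Decidable P) (f : ∀ {x} → P x → Fin l) →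
              (∀ {x y} (px : P x) (py : P y) → f px ≡ f py → x ≡ y) → ∣ subsetOf P? ∣ ≤ l
∣subsetOf∣≤ P? f f-inj =
  ∣∣≤-injection (λ x∈ → f (∈subsetOf⁻ P? x∈)) λ x∈ y∈ → f-inj (∈subsetOf⁻ P? x∈) (∈subsetOf⁻ P? y∈)

Any-map⁻ : ∀ {a b p} {A : Set a} {B : Set b} {P : Pred B p} {f : A → B} {m : Maybe A} →
           Any P (map f m) → ∃ λ x → m ≡ just x × P (f x)
Any-map⁻ {m = just x} (just px) = x , refl , px

remQuot-injective : ∀ {k} l {i j : Fin (k * l)} → remQuot {k} l i ≡ remQuot l j → i ≡ j
remQuot-injective {k} l {i} {j} e =
  trans (sym (combine-remQuot {k} l i)) (trans (cong (uncurry combine) e) (combine-remQuot {k} l j))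

anyFin : ∀ k → Maybe (Fin k)
anyFin zero = nothing
anyFin (suc k) = just zero

anyFin-just : ∀ {k} → Fin k → ∃ λ d → anyFin k ≡ just d
anyFin-just zero = zero , refl
anyFin-just (suc _) = zero , refl

∈⇒T : ∀ {k} {x} {A : Subset k} → x ∈ A → T (lookup A x)
∈⇒T x∈A = subst T (sym ([]=⇒lookup x∈A)) _

record WinningStrategyOn {P : Set} (adjP : P → P → Bool) (hP gP : P → ℕ) : Set where
  field
    guessOn : (p : P) → ((q : P) → T (adjP p q) → Fin (hP q)) → Subset (hP p)
    guessOn-bound : ∀ p view → ∣ guessOn p view ∣ ≤ gP p
    guessOn-wins : (c : (p : P) → Fin (hP p)) → ∃ λ p → c p ∈ guessOn p (λ q _ → c q)

∣subst∣ : ∀ {k l} (e : k ≡ l) (A : Subset k) → ∣ subst Subset e A ∣ ≡ ∣ A ∣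
∣subst∣ refl A = refl

module _ {N} {P : Set} {G : Graph N} {h g : Fin N → ℕ}
         {adjP : P → P → Bool} {hP gP : P → ℕ}
         (to : Fin N → P) (from : P → Fin N) (to∘from : ∀ p → to (from p) ≡ p)
         (adj≡ : ∀ u v → adj G u v ≡ adjP (to u) (to v))
         (h≡ : ∀ v → h v ≡ hP (to v)) (g≡ : ∀ v → g v ≡ gP (to v)) where

  private
    h∘from≡ : ∀ q → h (from q) ≡ hP q
    h∘from≡ q = trans (h≡ (from q)) (cong hP (to∘from q))

    viewOn : ∀ v → NbView G h v → (q : P) → T (adjP (to v) q) → Fin (hP q)
    viewOn v view q t = subst Fin (h∘from≡ q)
      (view (from q) (subst T (sym (trans (adj≡ v (from q)) (cong (adjP (to v)) (to∘from q)))) t))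

    ∈-transport : (F : (p : P) → Subset (hP p)) {p p′ : P} (e : p′ ≡ p) {H : ℕ} (eH : H ≡ hP p′)
                  (x : Fin H) → subst Fin (trans eH (cong hP e)) x ∈ F p → x ∈ subst Subset (sym eH) (F p′)
    ∈-transport F refl refl x x∈ = x∈

  relabel : WinningStrategyOn adjP hP gP → WinningGame G h g
  relabel σ = strategy , wins
    where
    open WinningStrategyOn σ
    strategy : Strategy G h g
    strategy = record
      { guess = λ v view → subst Subset (sym (h≡ v)) (guessOn (to v) (viewOn v view))
      ; bound = λ v view → subst₂ _≤_ (sym (∣subst∣ (sym (h≡ v)) _)) (sym (g≡ v)) (guessOn-bound (to v) _)
      }
    wins : Winning strategy
    wins c with guessOn-wins (λ q → subst Fin (h∘from≡ q) (c (from q)))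
    ... | p , c∈ = from p , ∈-transport (λ p′ → guessOn p′ (λ q _ → subst Fin (h∘from≡ q) (c (from q))))
                              (to∘from p) (h≡ (from p)) (c (from p)) c∈

module Gluing {n m : ℕ} (G : Graph n) (G' : Graph (suc m)) (z : Fin (suc m))
  (h g : Fin n → ℕ) (h' g' : Fin (suc m) → ℕ)
  (σ' : Strategy G' h' g') (σ'-wins : Winning σ')
  (S I : Subset n) (I⊆S : I ⊆ S)
  (σ : Strategy G h g) (σ-wins : Winning σ) (predictable : Predictable σ S I)
  (s a b : Fin n → ℕ)
  (factor : ∀ v → v ∈ I → (g v ≡ s v * a v) × (h' z ≡ s v * b v)) where

  open Predictable predictable

  data Role (u : Fin n) : Set where
    inI   : u ∈ I → Role u
    inS∖I : u ∈ S → Role u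
    ∉S    : u ∉ S → Role u

  -- Generalised over the Booleans so that h̃-roleOf can match on them.
  roleOf : ∀ u {i j} → lookup I u ≡ i → lookup S u ≡ j → Role u
  roleOf u {true}          eI eS = inI (lookup⇒[]= u I eI)
  roleOf u {false} {true}  eI eS = inS∖I (lookup⇒[]= u S eS)
  roleOf u {false} {false} eI eS = ∉S (λ u∈S → contradiction (trans (sym ([]=⇒lookup u∈S)) eS) λ ())

  role : ∀ u → Role u
  role u = roleOf u refl refl

  h̃ : ∀ {u} → Role u → ℕ
  h̃ {u} (inI _)   = h u * b u
  h̃ {u} (inS∖I _) = h u * h' z
  h̃ {u} (∉S _)    = h u

  g̃ : ∀ {u} → Role u → ℕ
  g̃ {u} (inI _)   = a u * g' z
  g̃ {u} (inS∖I _) = g u * g' z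
  g̃ {u} (∉S _)    = g u

  h̃-roleOf : ∀ u {i j} (eI : lookup I u ≡ i) (eS : lookup S u ≡ j) →
             (if i then h u * b u else if j then h u * h' z else h u) ≡ h̃ (roleOf u eI eS)
  h̃-roleOf u {true}          eI eS = refl
  h̃-roleOf u {false} {true}  eI eS = refl
  h̃-roleOf u {false} {false} eI eS = refl

  g̃-roleOf : ∀ u {i j} (eI : lookup I u ≡ i) (eS : lookup S u ≡ j) →
             (if i then a u * g' z else if j then g u * g' z else g u) ≡ g̃ (roleOf u eI eS)
  g̃-roleOf u {true}          eI eS = refl
  g̃-roleOf u {false} {true}  eI eS = refl
  g̃-roleOf u {false} {false} eI eS = refl

  gColour : ∀ {u} (r : Role u) → Fin (h̃ r) → Fin (h u)
  gColour {u} (inI _)   col = proj₁ (remQuot {h u} (b u) col)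
  gColour {u} (inS∖I _) col = proj₁ (remQuot {h u} (h' z) col)
  gColour     (∉S _)    col = col

  -- A position i < s·a splits into a block i / a < s and an offset; the block and e < b' give a
  -- colour < s·b' = h'(z).
  zCode : ∀ {u} → u ∈ I → Fin (b u) → Fin (s u * a u) → Fin (h' z)
  zCode {u} u∈I e i = subst Fin (sym (proj₂ (factor u u∈I))) (combine (proj₁ (remQuot {s u} (a u) i)) e)

  zCode-injective : ∀ {u} (u∈I : u ∈ I) {e e′ i i′} → zCode u∈I e i ≡ zCode u∈I e′ i′ →
                    proj₁ (remQuot {s u} (a u) i) ≡ proj₁ (remQuot {s u} (a u) i′) × e ≡ e′
  zCode-injective {u} u∈I {e} {e′} {i} {i′} eq =
    combine-injective (proj₁ (remQuot {s u} (a u) i)) e (proj₁ (remQuot {s u} (a u) i′)) e′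
      (subst-injective (sym (proj₂ (factor u u∈I))) eq)

  -- answerOf gives the named set A_u of u ∈ I: the predictable pair's answer for the other vertices,
  -- the set u actually names for u itself.
  zFromHat : ∀ {u} (r : Role u) → (u ∈ I → Subset (h u)) → Fin (h̃ r) → Maybe (Fin (h' z))
  zFromHat {u} (inI u∈I) answerOf col =
    map (zCode u∈I (proj₂ (remQuot {h u} (b u) col)))
        (index (s u * a u) (answerOf u∈I) (proj₁ (remQuot {h u} (b u) col)))
  zFromHat {u} (inS∖I _) _ col = just (proj₂ (remQuot {h u} (h' z) col))
  zFromHat     (∉S _)    _ _   = nothing

  Guessed : ∀ {u} (r : Role u) → Subset (h u) → Subset (h' z) → Pred (Fin (h̃ r)) _
  Guessed r A Z col = gColour r col ∈ A × Any (_∈ Z) (zFromHat r (λ _ → A) col)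

  guessed? : ∀ {u} (r : Role u) A Z → Decidable (Guessed r A Z)
  guessed? r A Z col = (gColour r col ∈? A) ×-dec Any.dec (_∈? Z) (zFromHat r (λ _ → A) col)

  guessV : ∀ {u} (r : Role u) → Subset (h u) → (u ∈ S → Subset (h' z)) → Subset (h̃ r)
  guessV (inI u∈I)   A Z = subsetOf (guessed? (inI u∈I) A (Z (I⊆S u∈I)))
  guessV (inS∖I u∈S) A Z = subsetOf (guessed? (inS∖I u∈S) A (Z u∈S))
  guessV (∉S _)      A Z = A

  zFromHat-inI-hit : ∀ {u} (u∈I : u ∈ I) {A Z col} → Any (_∈ Z) (zFromHat (inI u∈I) (λ _ → A) col) →
                     ∃ λ i → index (s u * a u) A (proj₁ (remQuot {h u} (b u) col)) ≡ just i ×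
                             zCode u∈I (proj₂ (remQuot {h u} (b u) col)) i ∈ Z
  zFromHat-inI-hit u∈I = Any-map⁻

  ∣guessed-inI∣≤ : ∀ {u} (u∈I : u ∈ I) A Z → ∣ subsetOf (guessed? (inI u∈I) A Z) ∣ ≤ a u * ∣ Z ∣
  ∣guessed-inI∣≤ {u} u∈I A Z = ∣subsetOf∣≤ (guessed? (inI u∈I) A Z) code code-injective
    where
    code : ∀ {col} → Guessed (inI u∈I) A Z col → Fin (a u * ∣ Z ∣)
    code (_ , hit) with i , _ , i∈Z ← zFromHat-inI-hit u∈I hit =
      combine (proj₂ (remQuot {s u} (a u) i)) (rank i∈Z)
    code-injective : ∀ {col col′} (p : Guessed (inI u∈I) A Z col) (p′ : Guessed (inI u∈I) A Z col′) →
                     code p ≡ code p′ → col ≡ col′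
    code-injective (_ , hit) (_ , hit′) eq
      with i , index≡ , i∈Z ← zFromHat-inI-hit u∈I hit | i′ , index≡′ , i′∈Z ← zFromHat-inI-hit u∈I hit′
      with offset≡ , rank≡ ← combine-injective (proj₂ (remQuot {s u} (a u) i)) (rank i∈Z)
                                                (proj₂ (remQuot {s u} (a u) i′)) (rank i′∈Z) eq
      with block≡ , e≡ ← zCode-injective u∈I (rank-injective i∈Z i′∈Z rank≡)
      with refl ← remQuot-injective {s u} (a u) (cong₂ _,_ block≡ offset≡)
      = remQuot-injective {h u} (b u) (cong₂ _,_ (index-injective index≡ index≡′) e≡)

  ∣guessed-inS∖I∣≤ : ∀ {u} (u∈S : u ∈ S) A Z → ∣ subsetOf (guessed? (inS∖I u∈S) A Z) ∣ ≤ ∣ A ∣ * ∣ Z ∣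
  ∣guessed-inS∖I∣≤ {u} u∈S A Z = ∣subsetOf∣≤ (guessed? (inS∖I u∈S) A Z) code code-injective
    where
    code : ∀ {col} → Guessed (inS∖I u∈S) A Z col → Fin (∣ A ∣ * ∣ Z ∣)
    code (c∈A , just e∈Z) = combine (rank c∈A) (rank e∈Z)
    code-injective : ∀ {col col′} (p : Guessed (inS∖I u∈S) A Z col) (p′ : Guessed (inS∖I u∈S) A Z col′) →
                     code p ≡ code p′ → col ≡ col′
    code-injective (c∈A , just e∈Z) (c′∈A , just e′∈Z) eq
      with c≡ , e≡ ← combine-injective (rank c∈A) (rank e∈Z) (rank c′∈A) (rank e′∈Z) eq =
      remQuot-injective {h u} (h' z) (cong₂ _,_ (rank-injective c∈A c′∈A c≡) (rank-injective e∈Z e′∈Z e≡))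

  guessV-bound : ∀ {u} (r : Role u) A Z → ∣ A ∣ ≤ g u → (∀ u∈S → ∣ Z u∈S ∣ ≤ g' z) →
                 ∣ guessV r A Z ∣ ≤ g̃ r
  guessV-bound {u} (inI u∈I) A Z _ ∣Z∣≤ =
    ≤-trans (∣guessed-inI∣≤ u∈I A (Z (I⊆S u∈I))) (*-monoʳ-≤ (a u) (∣Z∣≤ (I⊆S u∈I)))
  guessV-bound (inS∖I u∈S) A Z ∣A∣≤ ∣Z∣≤ =
    ≤-trans (∣guessed-inS∖I∣≤ u∈S A (Z u∈S)) (*-mono-≤ ∣A∣≤ (∣Z∣≤ u∈S))
  guessV-bound (∉S _) A Z ∣A∣≤ _ = ∣A∣≤

  guessV-∉S : ∀ {u} (r : Role u) {A Z col} → u ∉ S → gColour r col ∈ A → col ∈ guessV r A Z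
  guessV-∉S (inI u∈I)   u∉S _   = contradiction (I⊆S u∈I) u∉S
  guessV-∉S (inS∖I u∈S) u∉S _   = contradiction u∈S u∉S
  guessV-∉S (∉S _)      _   c∈A = c∈A

  guessV-∈ : ∀ {u} (r : Role u) {A Z col d} → gColour r col ∈ A → zFromHat r (λ _ → A) col ≡ just d →
             (∀ u∈S → d ∈ Z u∈S) → col ∈ guessV r A Z
  guessV-∈ (inI u∈I) c∈A zFromHat≡ d∈Z =
    ∈subsetOf⁺ (guessed? (inI u∈I) _ _) (c∈A , subst (Any (_∈ _)) (sym zFromHat≡) (just (d∈Z (I⊆S u∈I))))
  guessV-∈ (inS∖I u∈S) c∈A refl d∈Z = ∈subsetOf⁺ (guessed? (inS∖I u∈S) _ _) (c∈A , just (d∈Z u∈S))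

  zFromHat-complete : ∀ {u} (r : Role u) {A col} → u ∈ S → gColour r col ∈ A → ∣ A ∣ ≤ g u →
                      ∃ λ d → zFromHat r (λ _ → A) col ≡ just d
  zFromHat-complete {u} (inI u∈I) {A} _ c∈A ∣A∣≤g
    with i , index≡ ← index-complete c∈A (subst (∣ A ∣ ≤_) (proj₁ (factor u u∈I)) ∣A∣≤g)
    rewrite index≡ = _ , refl
  zFromHat-complete (inS∖I _) _ _ _ = _ , refl
  zFromHat-complete (∉S u∉S) u∈S _ _ = contradiction u∈S u∉S

  zFromHat-cong : ∀ {u} (r : Role u) {answerOf answerOf′ : u ∈ I → Subset (h u)} col →
                  (∀ u∈I → answerOf u∈I ≡ answerOf′ u∈I) → zFromHat r answerOf col ≡ zFromHat r answerOf′ col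
  zFromHat-cong (inI u∈I) col same rewrite same u∈I = refl
  zFromHat-cong (inS∖I _) col _ = refl
  zFromHat-cong (∉S _)    col _ = refl

  P : Set
  P = Fin n ⊎ Fin m

  hP : P → ℕ
  hP (inj₁ u) = h̃ (role u)
  hP (inj₂ x) = h' (punchIn z x)

  gP : P → ℕ
  gP (inj₁ u) = g̃ (role u)
  gP (inj₂ x) = g' (punchIn z x)

  adjP : P → P → Bool
  adjP = adjSum G G' z S

  ViewP : P → Set
  ViewP p = (q : P) → T (adjP p q) → Fin (hP q)

  SColours : Set
  SColours = (u : Fin n) → u ∈ S → Fin (hP (inj₁ u))

  onG : SColours → SView S h
  onG sc u u∈S = gColour (role u) (sc u u∈S)

  virtualZ : SColours → Maybe (Fin (h' z))
  virtualZ sc with pick (onG sc) ∈? S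
  ... | yes u∈S = zFromHat (role _) (answer (onG sc)) (sc _ u∈S)
  ... | no _    = nothing

  -- The G'-views handed to σ' are computed by g'Colour from the G̃-views, so that on an actual
  -- colouring c they agree definitionally with the colouring c' of Play (a strategy is an arbitrary
  -- function of its view, so pointwise equal views would not do). Needed w q: the hat of q enters
  -- the colour of the G'-vertex w, which for w = z is the virtual colour read off S.
  Needed : Fin (suc m) → P → Set
  Needed w (inj₁ u) = z ≡ w × u ∈ S
  Needed w (inj₂ x) = punchIn z x ≡ w

  g'Colour : Fin (h' z) → (w : Fin (suc m)) → ((q : P) → Needed w q → Fin (hP q)) → Fin (h' w)
  g'Colour d₀ w col with z ≟ w
  ... | yes refl = fromMaybe d₀ (virtualZ (λ u u∈S → col (inj₁ u) (refl , u∈S)))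
  ... | no z≢w   =
    subst (Fin ∘ h') (punchIn-punchOut z≢w) (col (inj₂ (punchOut z≢w)) (punchIn-punchOut z≢w))

  g'View : Fin (h' z) → ∀ {p} → ViewP p → (y : Fin (suc m)) →
           (∀ {w q} → T (adj G' y w) → Needed w q → T (adjP p q)) → NbView G' h' y
  g'View d₀ V y needed w y~w = g'Colour d₀ w (λ q nq → V q (needed y~w nq))

  needed-z : ∀ {u} → u ∈ S → ∀ {w q} → T (adj G' z w) → Needed w q → T (adjP (inj₁ u) q)
  needed-z _   {q = inj₁ _} z~z (refl , _) = ⊥-elim (subst T (irrefl G' z) z~z)
  needed-z u∈S {q = inj₂ _} z~w refl = Equivalence.from T-∧ (∈⇒T u∈S , z~w)

  needed-punchIn : ∀ x {w q} → T (adj G' (punchIn z x) w) → Needed w q → T (adjP (inj₂ x) q)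
  needed-punchIn x {q = inj₁ _} x~z (refl , v∈S) =
    Equivalence.from T-∧ (subst T (Graph.sym G' _ z) x~z , ∈⇒T v∈S)
  needed-punchIn x {q = inj₂ _} x~w refl = x~w

  -- These views need some colour of z; when h'(z) = 0 there is none and ∅ is named, which is
  -- harmless: a correct vertex of S chosen by the predictable pair would produce a colour of z.
  guessσ' : ∀ y → (Fin (h' z) → NbView G' h' y) → Subset (h' y)
  guessσ' y view = maybe′ (λ d₀ → guess σ' y (view d₀)) ⊥ (anyFin (h' z))

  guessσ'-bound : ∀ y view → ∣ guessσ' y view ∣ ≤ g' y
  guessσ'-bound y view with anyFin (h' z)
  ... | just d₀ = bound σ' y (view d₀)
  ... | nothing = subst (_≤ g' y) (sym (∣⊥∣≡0 (h' y))) z≤n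

  gView : ∀ u → ViewP (inj₁ u) → NbView G h u
  gView u V w u~w = gColour (role w) (V (inj₁ w) u~w)

  guessP : (p : P) → ViewP p → Subset (hP p)
  guessP (inj₁ u) V = guessV (role u) (guess σ u (gView u V))
                        (λ u∈S → guessσ' z (λ d₀ → g'View d₀ {inj₁ u} V z (needed-z u∈S)))
  guessP (inj₂ x) V = guessσ' (punchIn z x) (λ d₀ → g'View d₀ {inj₂ x} V (punchIn z x) (needed-punchIn x))

  guessP-bound : ∀ p V → ∣ guessP p V ∣ ≤ gP p
  guessP-bound (inj₁ u) V = guessV-bound (role u) _ _ (bound σ u (gView u V)) λ _ → guessσ'-bound z _
  guessP-bound (inj₂ x) V = guessσ'-bound (punchIn z x) _

  g'Colour-z : ∀ d₀ col →
               g'Colour d₀ z col ≡ fromMaybe d₀ (virtualZ (λ u u∈S → col (inj₁ u) (refl , u∈S)))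
  g'Colour-z d₀ col with z ≟ z
  ... | yes refl = refl
  ... | no z≢z   = contradiction refl z≢z

  g'Colour-punchIn : ∀ d₀ (c : (q : P) → Fin (hP q)) x →
                     g'Colour d₀ (punchIn z x) (λ q _ → c q) ≡ c (inj₂ x)
  g'Colour-punchIn d₀ c x with z ≟ punchIn z x
  ... | yes z≡ = contradiction (sym z≡) (punchInᵢ≢i z x)
  ... | no z≢  = subst-punchIn (punchIn-punchOut z≢)
    where
    subst-punchIn : ∀ {x′} (e : punchIn z x′ ≡ punchIn z x) →
                    subst (Fin ∘ h') e (c (inj₂ x′)) ≡ c (inj₂ x)
    subst-punchIn e with refl ← punchIn-injective z _ _ e | refl ← e = refl

  ∈guessσ' : ∀ {y view d₀ col} → anyFin (h' z) ≡ just d₀ →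
             col ∈ guess σ' y (view d₀) → col ∈ guessσ' y view
  ∈guessσ' {y} {view} {col = col} fallback≡ =
    subst (λ md → col ∈ maybe′ (λ d₀ → guess σ' y (view d₀)) ⊥ md) (sym fallback≡)

  module Play (c : (p : P) → Fin (hP p)) where

    cG : Coloring h
    cG u = gColour (role u) (c (inj₁ u))

    u : Fin n
    u = pick (restrict S cG)

    Wins : Set
    Wins = ∃ λ p → c p ∈ guessP p (λ q _ → c q)

    virtualZ-pick : u ∈ S →
                    virtualZ (λ v _ → c (inj₁ v)) ≡ zFromHat (role u) (answer (restrict S cG)) (c (inj₁ u))
    virtualZ-pick u∈S with pick (restrict S cG) ∈? S
    ... | yes _  = refl
    ... | no u∉S = contradiction u∈S u∉S

    module ThroughZ (u∈S : u ∈ S) (u✓ : Correct σ cG u) {d d₀ : Fin (h' z)}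
                    (zFromHat≡ : zFromHat (role u) (λ _ → guesses σ cG u) (c (inj₁ u)) ≡ just d)
                    (fallback≡ : anyFin (h' z) ≡ just d₀) where

      c' : Coloring h'
      c' w = g'Colour d₀ w (λ q _ → c q)

      virtualZ≡ : virtualZ (λ v _ → c (inj₁ v)) ≡ just d
      virtualZ≡ = begin
        virtualZ (λ v _ → c (inj₁ v))                           ≡⟨ virtualZ-pick u∈S ⟩
        zFromHat (role u) (answer (restrict S cG)) (c (inj₁ u)) ≡⟨ zFromHat-cong (role u) _ (answerCorrect cG) ⟩
        zFromHat (role u) (λ _ → guesses σ cG u) (c (inj₁ u))   ≡⟨ zFromHat≡ ⟩
        just d                                                  ∎
        where open ≡-Reasoning

      c'z≡d : c' z ≡ d
      c'z≡d = trans (g'Colour-z d₀ _) (cong (fromMaybe d₀) virtualZ≡)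

      c'-wins-at : ∀ y → c' y ∈ guesses σ' c' y → Dec (z ≡ y) → Wins
      c'-wins-at y y✓ (yes z≡y) = inj₁ u , guessV-∈ (role u) u✓ zFromHat≡ λ _ → ∈guessσ' fallback≡
        (subst (_∈ guesses σ' c' z) c'z≡d (subst (λ y → c' y ∈ guesses σ' c' y) (sym z≡y) y✓))
      c'-wins-at y y✓ (no z≢y) = inj₂ x , ∈guessσ' fallback≡
        (subst (_∈ guesses σ' c' (punchIn z x)) (g'Colour-punchIn d₀ c x)
          (subst (λ y → c' y ∈ guesses σ' c' y) (sym (punchIn-punchOut z≢y)) y✓))
        where
        x : Fin m
        x = punchOut z≢y

      wins : Wins
      wins with y , y✓ ← σ'-wins c' = c'-wins-at y y✓ (z ≟ y)

    wins-at : ∀ w → Correct σ cG w → Dec (w ∈ S) → Wins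
    wins-at w w✓ (no w∉S) = inj₁ w , guessV-∉S (role w) w∉S w✓
    wins-at w w✓ (yes w∈S)
      with u∈S , u✓ ← pickCorrect cG (w , w∈S , w✓)
      with d , zFromHat≡ ← zFromHat-complete (role u) u∈S u✓ (bound σ u _)
      with d₀ , fallback≡ ← anyFin-just d
      = ThroughZ.wins u∈S u✓ zFromHat≡ fallback≡

    wins : Wins
    wins with w , w✓ ← σ-wins cG = wins-at w w✓ (w ∈? S)

  winningStrategyOn : WinningStrategyOn adjP hP gP
  winningStrategyOn = record { guessOn = guessP ; guessOn-bound = guessP-bound ; guessOn-wins = Play.wins }

  tildeH≡hP : ∀ v → tildeH z S I h h' b v ≡ hP (splitAt n v)
  tildeH≡hP v with splitAt n v
  ... | inj₁ u = h̃-roleOf u refl refl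
  ... | inj₂ x = refl

  tildeG≡gP : ∀ v → tildeG z S I g g' a v ≡ gP (splitAt n v)
  tildeG≡gP v with splitAt n v
  ... | inj₁ u = g̃-roleOf u refl refl
  ... | inj₂ x = refl

theorem2p4 : ∀ {n m : ℕ} (G : Graph n) (G' : Graph (suc m)) (z : Fin (suc m))
    (h g : Fin n → ℕ) (h' g' : Fin (suc m) → ℕ) →
    WinningGame G' h' g' →
    (S I : Subset n) → I ⊆ S →
    (σ : Strategy G h g) → Winning σ → Predictable σ S I →
    (s a b : Fin n → ℕ) →
    (∀ v → v ∈ I → (g v ≡ s v * a v) × (h' z ≡ s v * b v)) →
    WinningGame (tildeGraph G G' z S) (tildeH z S I h h' b) (tildeG z S I g g' a)
theorem2p4 {n} {m} G G' z h g h' g' (σ' , σ'-wins) S I I⊆S σ σ-wins predictable s a b factor =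
  relabel (splitAt n) (join n m) (splitAt-join n m) (λ _ _ → refl) tildeH≡hP tildeG≡gP winningStrategyOn
  where open Gluing G G' z h g h' g' σ' σ'-wins S I I⊆S σ σ-wins predictable s a b factor
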